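{- Let $C$ be a cycle of even length in a graph, and let $P_1,P_2,P_3$ be bridges of $C$ that are paths of even length. Then: (1) if $P_1$ has even span, then $C\cup P_1$ contains a cycle of length divisible by $4$; (2) if $P_1,P_2$ are crossed on $C$, then $C\cup P_1\cup P_2$ contains a cycle of length divisible by $4$; (3) if $P_1,P_2,P_3$ are pairwise internally-disjoint, then $C\cup P_1\cup P_2\cup P_3$ contains a cycle of length divisible by $4$.
   Context: Graphs are finite and simple; lengths of paths/cycles count edges. A path $P$ from $x$ to $y$ is a bridge of the cycle $C$ if $P$ is nontrivial, $P$ and $C$ are edge-disjoint and $V(P)\cap V(C)=\{x,y\}$. For $x,y\in V(C)$ and a fixed orientation of $C$, $C[x,y]$ is the path on $C$ from $x$ to $y$ along the orientation. The span of a bridge $P$ with end-vertices $x,y$ is $\sigma_C(P)=\min\{|C[x,y]|,|C[y,x]|\}$. Two bridges $P_1,P_2$ with end-vertex sets $\{x_1,y_1\}$ and $\{x_2,y_2\}$ are crossed on $C$ if $P_1,P_2$ are vertex-disjoint and $x_1,x_2,y_1,y_2$ appear in this order along $C$. -}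

module Defs where

open import Data.Nat using (ℕ; zero; suc; _+_; _∸_; _≤_; _<_; _%_; _⊓_)
open import Data.Nat.Divisibility using (_∣_)
open import Data.Fin using (Fin; toℕ; fromℕ; inject₁) renaming (zero to fzero; suc to fsuc)
open import Data.Product using (Σ; ∃; ∃-syntax; _×_)
open import Data.Sum using (_⊎_)
open import Data.Empty using (⊥)
open import Relation.Nullary using (¬_)
open import Relation.Binary.PropositionalEquality using (_≡_)
open import Function.Definitions using (Injective)

record Graph : Set₁ where
  field
    n      : ℕ
    Adj    : Fin n → Fin n → Set
    sym    : ∀ {u v} → Adj u v → Adj v u
    irrefl : ∀ {u} → ¬ Adj u u
  V : Set
  V = Fin n

module _ (G : Graph) where
  open Graph G

  record Path : Set where
    field
      len  : ℕ
      vert : Fin (suc len) → V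
      inj  : Injective _≡_ _≡_ vert
      adj  : (i : Fin len) → Adj (vert (inject₁ i)) (vert (fsuc i))

  next : ∀ {k} → Fin k → Fin k
  next {suc k} i = Data.Nat.DivMod._mod_ (suc (toℕ i)) (suc k)
    where import Data.Nat.DivMod

  record Cycle : Set where
    field
      len    : ℕ
      3≤len  : 3 ≤ len
      vert   : Fin len → V
      inj    : Injective _≡_ _≡_ vert
      adj    : (i : Fin len) → Adj (vert i) (vert (next i))

  open Path
  open Cycle

  start end : Path → V
  start P = vert P fzero
  end   P = vert P (fromℕ (len P))

  OnP : Path → V → Set
  OnP P v = ∃[ i ] vert P i ≡ v

  OnC : Cycle → V → Set
  OnC C v = ∃[ i ] vert C i ≡ v

  Internal : Path → V → Set
  Internal P v = ∃[ i ] (vert P i ≡ v × 0 < toℕ i × toℕ i < len P)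

  EdgeP : Path → V → V → Set
  EdgeP P u v = ∃[ i ] ((vert P (inject₁ i) ≡ u × vert P (fsuc i) ≡ v)
                       ⊎ (vert P (inject₁ i) ≡ v × vert P (fsuc i) ≡ u))

  EdgeC : Cycle → V → V → Set
  EdgeC C u v = ∃[ i ] ((vert C i ≡ u × vert C (next i) ≡ v)
                       ⊎ (vert C i ≡ v × vert C (next i) ≡ u))

  Bridge : Cycle → Path → Set
  Bridge C P =
      1 ≤ len P
    × (∀ u v → EdgeP P u v → ¬ EdgeC C u v)
    × (∀ v → (OnP P v × OnC C v → v ≡ start P ⊎ v ≡ end P)
           × (v ≡ start P ⊎ v ≡ end P → OnP P v × OnC C v))

  -- |C[c_i, c_j]| along the orientation c_0 → c_1 → …  equals (j - i) mod len
  fwd : (C : Cycle) → Fin (len C) → Fin (len C) → ℕ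
  fwd C i j with len C
  ... | zero  = 0
  ... | suc k = ((suc k + toℕ j) ∸ toℕ i) % suc k

  SpanIs : Cycle → Path → ℕ → Set
  SpanIs C P s = ∃[ i ] ∃[ j ] (vert C i ≡ start P × vert C j ≡ end P
                               × s ≡ fwd C i j ⊓ fwd C j i)

  InOrder : Cycle → V → V → V → V → Set
  InOrder C a b c d = ∃[ ia ] ∃[ ib ] ∃[ ic ] ∃[ id ]
      (vert C ia ≡ a × vert C ib ≡ b × vert C ic ≡ c × vert C id ≡ d
      × 0 < fwd C ia ib × fwd C ia ib < fwd C ia ic × fwd C ia ic < fwd C ia id)

  Ends : Path → V → V → Set
  Ends P x y = (x ≡ start P × y ≡ end P) ⊎ (x ≡ end P × y ≡ start P)

  Crossed : Cycle → Path → Path → Set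
  Crossed C P₁ P₂ =
      (∀ v → OnP P₁ v → ¬ OnP P₂ v)
    × ∃[ x₁ ] ∃[ y₁ ] ∃[ x₂ ] ∃[ y₂ ]
        (Ends P₁ x₁ y₁ × Ends P₂ x₂ y₂ × InOrder C x₁ x₂ y₁ y₂)

  IntDisjoint : Path → Path → Set
  IntDisjoint P Q = ∀ v → (Internal P v → ¬ OnP Q v) × (Internal Q v → ¬ OnP P v)

  -- The subgraph whose edge set is H contains a cycle of length divisible by 4
  -- (a cycle lies in a subgraph iff all its edges do).
  HasC4In : (V → V → Set) → Set
  HasC4In H = ∃[ D ] (4 ∣ len D × (∀ u v → EdgeC D u v → H u v))

  E∪₁ : Cycle → Path → V → V → Set
  E∪₁ C P₁ u v = EdgeC C u v ⊎ EdgeP P₁ u v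

  E∪₂ : Cycle → Path → Path → V → V → Set
  E∪₂ C P₁ P₂ u v = EdgeC C u v ⊎ EdgeP P₁ u v ⊎ EdgeP P₂ u v

  E∪₃ : Cycle → Path → Path → Path → V → V → Set
  E∪₃ C P₁ P₂ P₃ u v = EdgeC C u v ⊎ EdgeP P₁ u v ⊎ EdgeP P₂ u v ⊎ EdgeP P₃ u v

{-# OPTIONS --safe #-}
module Submission where

-- Let L be the length of C.  If 4 ∣ L, C itself is the required cycle, so let L ≡ 2 (mod 4).
-- A bridge of even length l whose ends cut C into arcs of lengths d and L − d closes two cycles,
-- of lengths l + d and l + (L − d), with total 2l + L ≡ 2 (mod 4); when d is even both lengths
-- are even, so one of them is divisible by 4.  Two crossed bridges whose spans a + b and b + c
-- are odd (the arcs between consecutive ends having lengths a, b, c, d) close, with the pairs of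
-- opposite arcs {a, c} and {b, d}, two cycles that are again even with total ≡ 2 (mod 4).
-- For three bridges with odd spans the lengths l + d are odd, so two bridges agree mod 4; whether
-- these two are separated, nested or crossing on C, some cycle through both of them and two arcs
-- of C then has length divisible by 4.

open import Defs
open import Data.Nat using (ℕ; zero; suc; _+_; _∸_; _≤_; _<_; _≤ᵇ_; _%_; z≤n; s≤s; NonZero; >-nonZero)
open import Data.Nat.Properties
open import Data.Nat.DivMod
  using (_mod_; %-distribˡ-+; m%n%n≡m%n; m<n⇒m%n≡m; m≤n⇒m%n≡m; n%n≡0; [m+n]%n≡m%n; m≤n⇒[n∸m]%m≡n%m; m%n<n)
open import Data.Nat.Divisibility using (_∣_; _∣?_; divides; ∣m∣n⇒∣m+n; ∣m+n∣m⇒∣n; ∣-refl; ∣-trans; ∣⇒≤)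
open import Data.Nat.Tactic.RingSolver using (solve)
open import Data.List using (_∷_; [])
open import Data.Bool using (true; false; if_then_else_; T)
open import Data.Unit using (tt)
open import Data.Fin using (Fin; toℕ; fromℕ<; inject₁)
open import Data.Fin.Properties using (toℕ-injective; toℕ-fromℕ<; toℕ<n; toℕ-fromℕ; toℕ-inject₁)
open import Data.Product using (Σ-syntax; ∃-syntax; _×_; _,_; proj₁; proj₂)
open import Data.Sum using (_⊎_; inj₁; inj₂; [_,_]′; swap) renaming (map to map⊎)
open import Data.Empty using (⊥; ⊥-elim)
open import Function using (_∘_)
open import Relation.Nullary using (¬_; yes; no)
open import Relation.Binary.Definitions using (tri<; tri≈; tri>)
open import Relation.Binary.PropositionalEquality
open Graph using (V; Adj)
open Cycle using (len; vert; inj; 3≤len)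

-- Arithmetic

∣-respʳ : ∀ {d m n} → m ≡ n → d ∣ m → d ∣ n
∣-respʳ = subst (_ ∣_)

∣x+y+c⇒∣y+x+c : ∀ x y {d c} → d ∣ x + y + c → d ∣ y + x + c
∣x+y+c⇒∣y+x+c x y {c = c} = ∣-respʳ (cong (_+ c) (+-comm x y))

2∣n⇒4∣n⊎4∣n+2 : ∀ {n} → 2 ∣ n → 4 ∣ n ⊎ 4 ∣ n + 2
2∣n⇒4∣n⊎4∣n+2 {0} _ = inj₁ (divides 0 refl)
2∣n⇒4∣n⊎4∣n+2 {1} (divides (suc _) ())
2∣n⇒4∣n⊎4∣n+2 {2} _ = inj₂ (divides 1 refl)
2∣n⇒4∣n⊎4∣n+2 {3} (divides (suc (suc _)) ())
2∣n⇒4∣n⊎4∣n+2 {suc (suc (suc (suc n)))} 2∣4+n =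
  map⊎ (∣m∣n⇒∣m+n ∣-refl) (∣m∣n⇒∣m+n ∣-refl) (2∣n⇒4∣n⊎4∣n+2 (∣m+n∣m⇒∣n 2∣4+n (divides 2 refl)))

¬2∣n⇒2∣1+n : ∀ {n} → ¬ 2 ∣ n → 2 ∣ suc n
¬2∣n⇒2∣1+n {0} ¬2∣0 = ⊥-elim (¬2∣0 (divides 0 refl))
¬2∣n⇒2∣1+n {1} _ = ∣-refl
¬2∣n⇒2∣1+n {suc (suc n)} ¬2∣2+n = ∣m∣n⇒∣m+n ∣-refl (¬2∣n⇒2∣1+n (λ 2∣n → ¬2∣2+n (∣m∣n⇒∣m+n ∣-refl 2∣n)))

2∣n⇒4∣n+n : ∀ {n} → 2 ∣ n → 4 ∣ n + n
2∣n⇒4∣n+n (divides q refl) = divides q (solve (q ∷ []))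

2∣n+n : ∀ n → 2 ∣ n + n
2∣n+n n = divides n (solve (n ∷ []))

4∣n+2⇒2∣n : ∀ {n} → 4 ∣ n + 2 → 2 ∣ n
4∣n+2⇒2∣n {n} 4∣n+2 = ∣m+n∣m⇒∣n (∣-respʳ (+-comm n 2) (∣-trans (divides 2 refl) 4∣n+2)) ∣-refl

¬2∣m⇒¬2∣n⇒2∣m+n : ∀ {m n} → ¬ 2 ∣ m → ¬ 2 ∣ n → 2 ∣ m + n
¬2∣m⇒¬2∣n⇒2∣m+n {m} {n} ¬2∣m ¬2∣n =
  ∣m+n∣m⇒∣n (∣-respʳ sum (∣m∣n⇒∣m+n (¬2∣n⇒2∣1+n ¬2∣m) (¬2∣n⇒2∣1+n ¬2∣n))) ∣-refl
  where
  sum : suc m + suc n ≡ 2 + (m + n)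
  sum = solve (m ∷ n ∷ [])

2∣m⇒¬2∣n⇒¬2∣m+n : ∀ {m n} → 2 ∣ m → ¬ 2 ∣ n → ¬ 2 ∣ m + n
2∣m⇒¬2∣n⇒¬2∣m+n 2∣m ¬2∣n 2∣m+n = ¬2∣n (∣m+n∣m⇒∣n 2∣m+n 2∣m)

2∣x⇒4∣x+y+2⇒4∣x⊎4∣y : ∀ {x y} → 2 ∣ x → 4 ∣ x + y + 2 → 4 ∣ x ⊎ 4 ∣ y
2∣x⇒4∣x+y+2⇒4∣x⊎4∣y {x} {y} 2∣x 4∣x+y+2 with 2∣n⇒4∣n⊎4∣n+2 2∣x
... | inj₁ 4∣x   = inj₁ 4∣x
... | inj₂ 4∣x+2 = inj₂ (∣m+n∣m⇒∣n (∣-respʳ sum 4∣x+y+2) 4∣x+2)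
  where
  sum : x + y + 2 ≡ x + 2 + y
  sum = solve (x ∷ y ∷ [])

¬2∣n⇒4∣1+n⊎4∣3+n : ∀ {n} → ¬ 2 ∣ n → 4 ∣ suc n ⊎ 4 ∣ suc n + 2
¬2∣n⇒4∣1+n⊎4∣3+n ¬2∣n = 2∣n⇒4∣n⊎4∣n+2 (¬2∣n⇒2∣1+n ¬2∣n)

4∣1+m⇒4∣1+n⇒4∣m+n+2 : ∀ {m n} → 4 ∣ suc m → 4 ∣ suc n → 4 ∣ m + n + 2
4∣1+m⇒4∣1+n⇒4∣m+n+2 {m} {n} 4∣1+m 4∣1+n = ∣-respʳ sum (∣m∣n⇒∣m+n 4∣1+m 4∣1+n)
  where
  sum : suc m + suc n ≡ m + n + 2
  sum = solve (m ∷ n ∷ [])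

4∣3+m⇒4∣3+n⇒4∣m+n+2 : ∀ {m n} → 4 ∣ suc m + 2 → 4 ∣ suc n + 2 → 4 ∣ m + n + 2
4∣3+m⇒4∣3+n⇒4∣m+n+2 {m} {n} 4∣3+m 4∣3+n = ∣m+n∣m⇒∣n (∣-respʳ sum (∣m∣n⇒∣m+n 4∣3+m 4∣3+n)) ∣-refl
  where
  sum : suc m + 2 + (suc n + 2) ≡ 4 + (m + n + 2)
  sum = solve (m ∷ n ∷ [])

-- For odd x and y, 4 ∣ x + y + 2 says x ≡ y (mod 4).
odd-pigeonhole : ∀ {x y z} → ¬ 2 ∣ x → ¬ 2 ∣ y → ¬ 2 ∣ z
  → 4 ∣ x + y + 2 ⊎ 4 ∣ x + z + 2 ⊎ 4 ∣ y + z + 2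
odd-pigeonhole ¬2∣x ¬2∣y ¬2∣z
  with ¬2∣n⇒4∣1+n⊎4∣3+n ¬2∣x | ¬2∣n⇒4∣1+n⊎4∣3+n ¬2∣y | ¬2∣n⇒4∣1+n⊎4∣3+n ¬2∣z
... | inj₁ x₁ | inj₁ y₁ | _       = inj₁ (4∣1+m⇒4∣1+n⇒4∣m+n+2 x₁ y₁)
... | inj₂ x₃ | inj₂ y₃ | _       = inj₁ (4∣3+m⇒4∣3+n⇒4∣m+n+2 x₃ y₃)
... | inj₁ x₁ | inj₂ _  | inj₁ z₁ = inj₂ (inj₁ (4∣1+m⇒4∣1+n⇒4∣m+n+2 x₁ z₁))
... | inj₁ _  | inj₂ y₃ | inj₂ z₃ = inj₂ (inj₂ (4∣3+m⇒4∣3+n⇒4∣m+n+2 y₃ z₃))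
... | inj₂ x₃ | inj₁ _  | inj₂ z₃ = inj₂ (inj₁ (4∣3+m⇒4∣3+n⇒4∣m+n+2 x₃ z₃))
... | inj₂ _  | inj₁ y₁ | inj₁ z₁ = inj₂ (inj₂ (4∣1+m⇒4∣1+n⇒4∣m+n+2 y₁ z₁))

-- The residues of the candidate cycle lengths in the four configurations of bridges: the l's
-- are lengths of bridges, the other variables lengths of arcs of C.
even-span-mod4 : ∀ {l d e} → 2 ∣ l → 2 ∣ d → 4 ∣ d + e + 2 → 4 ∣ l + d ⊎ 4 ∣ l + e
even-span-mod4 {l} {d} {e} 2∣l 2∣d 4∣L+2 =
  2∣x⇒4∣x+y+2⇒4∣x⊎4∣y (∣m∣n⇒∣m+n 2∣l 2∣d) (∣-respʳ sum (∣m∣n⇒∣m+n (2∣n⇒4∣n+n 2∣l) 4∣L+2))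
  where
  sum : l + l + (d + e + 2) ≡ l + d + (l + e) + 2
  sum = solve (l ∷ d ∷ e ∷ [])

crossing-mod4 : ∀ {l₁ l₂ a b c d} → 2 ∣ l₁ → 2 ∣ l₂ → ¬ 2 ∣ a + b → ¬ 2 ∣ b + c
  → 4 ∣ a + b + c + d + 2 → 4 ∣ (l₁ + c) + (l₂ + a) ⊎ 4 ∣ (l₁ + b) + (l₂ + d)
crossing-mod4 {l₁} {l₂} {a} {b} {c} {d} 2∣l₁ 2∣l₂ ¬2∣a+b ¬2∣b+c 4∣L+2 =
  2∣x⇒4∣x+y+2⇒4∣x⊎4∣y (∣-respʳ split (∣m∣n⇒∣m+n (∣m∣n⇒∣m+n 2∣l₁ 2∣l₂) 2∣a+c))
    (∣-respʳ sum (∣m∣n⇒∣m+n (∣m∣n⇒∣m+n (2∣n⇒4∣n+n 2∣l₁) (2∣n⇒4∣n+n 2∣l₂)) 4∣L+2))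
  where
  2∣a+c : 2 ∣ a + c
  2∣a+c = ∣m+n∣m⇒∣n (∣-respʳ regroup (¬2∣m⇒¬2∣n⇒2∣m+n ¬2∣a+b ¬2∣b+c)) (2∣n+n b)
    where
    regroup : a + b + (b + c) ≡ b + b + (a + c)
    regroup = solve (a ∷ b ∷ c ∷ [])
  split : l₁ + l₂ + (a + c) ≡ l₁ + c + (l₂ + a)
  split = solve (l₁ ∷ l₂ ∷ a ∷ c ∷ [])
  sum : l₁ + l₁ + (l₂ + l₂) + (a + b + c + d + 2) ≡ l₁ + c + (l₂ + a) + (l₁ + b + (l₂ + d)) + 2
  sum = solve (l₁ ∷ l₂ ∷ a ∷ b ∷ c ∷ d ∷ [])

nested-mod4 : ∀ {l₁ l₂ e₁ s e₂} → ¬ 2 ∣ s → 4 ∣ (l₁ + (e₁ + s + e₂)) + (l₂ + s) + 2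
  → 4 ∣ (l₁ + e₁) + (l₂ + e₂)
nested-mod4 {l₁} {l₂} {e₁} {s} {e₂} ¬2∣s 4∣τ₁+τ₂+2 =
  ∣m+n∣m⇒∣n (∣-respʳ sum 4∣τ₁+τ₂+2) (2∣n⇒4∣n+n (¬2∣n⇒2∣1+n ¬2∣s))
  where
  sum : l₁ + (e₁ + s + e₂) + (l₂ + s) + 2 ≡ suc s + suc s + (l₁ + e₁ + (l₂ + e₂))
  sum = solve (l₁ ∷ l₂ ∷ e₁ ∷ s ∷ e₂ ∷ [])

separated-mod4 : ∀ {l₁ l₂ d₁ e₁ d₂ e₂} → ¬ 2 ∣ d₁ → ¬ 2 ∣ d₂
  → 4 ∣ (l₁ + d₁) + (l₂ + d₂) + 2 → 4 ∣ d₁ + e₁ + d₂ + e₂ + 2 → 4 ∣ (l₁ + e₁) + (l₂ + e₂)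
separated-mod4 {l₁} {l₂} {d₁} {e₁} {d₂} {e₂} ¬2∣d₁ ¬2∣d₂ 4∣τ₁+τ₂+2 4∣L+2 =
  ∣m+n∣m⇒∣n (∣-respʳ sum (∣m∣n⇒∣m+n 4∣τ₁+τ₂+2 (2∣n⇒4∣n+n 2∣e₁+e₂))) 4∣L+2
  where
  2∣e₁+e₂ : 2 ∣ e₁ + e₂
  2∣e₁+e₂ = ∣m+n∣m⇒∣n (∣-respʳ regroup (4∣n+2⇒2∣n 4∣L+2)) (¬2∣m⇒¬2∣n⇒2∣m+n ¬2∣d₁ ¬2∣d₂)
    where
    regroup : d₁ + e₁ + d₂ + e₂ ≡ d₁ + d₂ + (e₁ + e₂)
    regroup = solve (d₁ ∷ e₁ ∷ d₂ ∷ e₂ ∷ [])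
  sum : l₁ + d₁ + (l₂ + d₂) + 2 + (e₁ + e₂ + (e₁ + e₂)) ≡ d₁ + e₁ + d₂ + e₂ + 2 + (l₁ + e₁ + (l₂ + e₂))
  sum = solve (l₁ ∷ l₂ ∷ d₁ ∷ e₁ ∷ d₂ ∷ e₂ ∷ [])

∸-telescope : ∀ {a b c} → a ≤ b → b ≤ c → (b ∸ a) + (c ∸ b) ≡ c ∸ a
∸-telescope {a} {b} {c} a≤b b≤c = +-cancelˡ-≡ a _ _ (begin
  a + ((b ∸ a) + (c ∸ b))   ≡⟨ +-assoc a _ _ ⟨
  a + (b ∸ a) + (c ∸ b)     ≡⟨ cong (_+ (c ∸ b)) (m+[n∸m]≡n a≤b) ⟩
  b + (c ∸ b)               ≡⟨ m+[n∸m]≡n b≤c ⟩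
  c                         ≡⟨ m+[n∸m]≡n (≤-trans a≤b b≤c) ⟨
  a + (c ∸ a)               ∎)
  where open ≡-Reasoning

∸-telescope₃ : ∀ {a b c d} → a ≤ b → b ≤ c → c ≤ d → (b ∸ a) + (c ∸ b) + (d ∸ c) ≡ d ∸ a
∸-telescope₃ {c = c} {d} a≤b b≤c c≤d =
  trans (cong (_+ (d ∸ c)) (∸-telescope a≤b b≤c)) (∸-telescope (≤-trans a≤b b≤c) c≤d)

∸-telescope₄ : ∀ {a b c d e} → a ≤ b → b ≤ c → c ≤ d → d ≤ e → (b ∸ a) + (c ∸ b) + (d ∸ c) + (e ∸ d) ≡ e ∸ a
∸-telescope₄ {d = d} {e} a≤b b≤c c≤d d≤e =
  trans (cong (_+ (e ∸ d)) (∸-telescope₃ a≤b b≤c c≤d)) (∸-telescope (≤-trans a≤b (≤-trans b≤c c≤d)) d≤e)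

even⇒2≤ : ∀ {l} → 1 ≤ l → 2 ∣ l → 2 ≤ l
even⇒2≤ 1≤l = ∣⇒≤ {{>-nonZero 1≤l}}

[m+n%d]%d≡[m+n]%d : ∀ m n d .{{_ : NonZero d}} → (m + n % d) % d ≡ (m + n) % d
[m+n%d]%d≡[m+n]%d m n d = begin
  (m + n % d) % d           ≡⟨ %-distribˡ-+ m (n % d) d ⟩
  (m % d + n % d % d) % d   ≡⟨ cong (λ r → (m % d + r) % d) (m%n%n≡m%n n d) ⟩
  (m % d + n % d) % d       ≡⟨ %-distribˡ-+ m n d ⟨
  (m + n) % d               ∎
  where open ≡-Reasoning

[m+k]%n≡m⇒k≡0 : ∀ {m k n} .{{_ : NonZero n}} → m < n → k < n → (m + k) % n ≡ m → k ≡ 0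
[m+k]%n≡m⇒k≡0 {m} {k} {n} m<n k<n [m+k]%n≡m with m + k <? n
... | yes m+k<n = +-cancelˡ-≡ m k 0 (trans (trans (sym (m<n⇒m%n≡m m+k<n)) [m+k]%n≡m) (sym (+-identityʳ m)))
... | no m+k≮n  = ⊥-elim (<-irrefl (+-cancelˡ-≡ m k n m+k≡m+n) k<n)
  where
  n≤m+k : n ≤ m + k
  n≤m+k = ≮⇒≥ m+k≮n
  m+k∸n<n : m + k ∸ n < n
  m+k∸n<n = subst (m + k ∸ n <_) (m+n∸n≡m n n) (∸-monoˡ-< (+-mono-< m<n k<n) n≤m+k)
  m+k≡m+n : m + k ≡ m + n
  m+k≡m+n = trans (sym (m∸n+n≡m n≤m+k))
    (cong (_+ n) (trans (sym (m<n⇒m%n≡m m+k∸n<n)) (trans (m≤n⇒[n∸m]%m≡n%m n≤m+k) [m+k]%n≡m)))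

-- Paths and cycles as functions on ℕ

Steps : {V : Set} → (V → V → Set) → (ℕ → V) → ℕ → Set
Steps H w k = ∀ {i} → i < k → H (w i) (w (suc i))

InjectiveBelow : {V : Set} → (ℕ → V) → ℕ → Set
InjectiveBelow w n = ∀ {i j} → i < n → j < n → w i ≡ w j → i ≡ j

Visits : {V : Set} → (ℕ → V) → ℕ → V → Set
Visits w k v = ∃[ t ] t ≤ k × w t ≡ v

record IsPath {V : Set} (H : V → V → Set) (w : ℕ → V) (k : ℕ) : Set where
  field
    steps     : Steps H w k
    injective : InjectiveBelow w (suc k)

record IsCycle {V : Set} (H : V → V → Set) (w : ℕ → V) (k : ℕ) : Set where
  field
    steps     : Steps H w k
    closed    : w k ≡ w 0
    injective : InjectiveBelow w k

split< : ∀ a t → t < a ⊎ ∃[ u ] t ≡ a + u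
split< zero    t       = inj₂ (t , refl)
split< (suc a) zero    = inj₁ (s≤s z≤n)
split< (suc a) (suc t) with split< a t
... | inj₁ t<a         = inj₁ (s≤s t<a)
... | inj₂ (u , t≡a+u) = inj₂ (u , cong suc t≡a+u)

split≤ : ∀ a t → t ≤ a ⊎ ∃[ u ] t ≡ a + suc u
split≤ zero    zero    = inj₁ z≤n
split≤ zero    (suc t) = inj₂ (t , refl)
split≤ (suc a) zero    = inj₁ z≤n
split≤ (suc a) (suc t) with split≤ a t
... | inj₁ t≤a           = inj₁ (s≤s t≤a)
... | inj₂ (u , t≡a+1+u) = inj₂ (u , cong suc t≡a+1+u)

-- Opaque, so that w₁, w₂ and a can be inferred from (w₁ ⟨ a ⟩++ w₂) t in the lemmas below.
opaque
  _⟨_⟩++_ : {V : Set} → (ℕ → V) → ℕ → (ℕ → V) → ℕ → V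
  (w₁ ⟨ a ⟩++ w₂) t = if t ≤ᵇ a then w₁ t else w₂ (t ∸ a)

reverse : {V : Set} → (ℕ → V) → ℕ → ℕ → V
reverse w k t = w (k ∸ t)

module _ {V : Set} {w₁ w₂ : ℕ → V} {a : ℕ} where

  opaque
    unfolding _⟨_⟩++_

    ++-left : ∀ {t} → t ≤ a → (w₁ ⟨ a ⟩++ w₂) t ≡ w₁ t
    ++-left {t} t≤a with t ≤ᵇ a | ≤⇒≤ᵇ t≤a
    ... | true | _ = refl

    ++-right-suc : ∀ u → (w₁ ⟨ a ⟩++ w₂) (a + suc u) ≡ w₂ (suc u)
    ++-right-suc u with (a + suc u) ≤ᵇ a in a+1+u≤ᵇa
    ... | false = cong w₂ (m+n∸m≡n a (suc u))
    ... | true  = ⊥-elim (m+1+n≰m a (≤ᵇ⇒≤ (a + suc u) a (subst T (sym a+1+u≤ᵇa) tt)))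

  ++-right : w₁ a ≡ w₂ 0 → ∀ u → (w₁ ⟨ a ⟩++ w₂) (a + u) ≡ w₂ u
  ++-right junction zero    = trans (cong (w₁ ⟨ a ⟩++ w₂) (+-identityʳ a)) (trans (++-left ≤-refl) junction)
  ++-right junction (suc u) = ++-right-suc u

  ++-steps : ∀ {H b} → w₁ a ≡ w₂ 0 → Steps H w₁ a → Steps H w₂ b → Steps H (w₁ ⟨ a ⟩++ w₂) (a + b)
  ++-steps {H} {b} junction steps₁ steps₂ {i} i<a+b with split< a i
  ... | inj₁ i<a = subst₂ H (sym (++-left (<⇒≤ i<a))) (sym (++-left i<a)) (steps₁ i<a)
  ... | inj₂ (u , refl) = subst₂ H (sym (++-right junction u))
        (sym (trans (cong (w₁ ⟨ a ⟩++ w₂) (sym (+-suc a u))) (++-right junction (suc u))))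
        (steps₂ (+-cancelˡ-< a u b i<a+b))

  ++-injective : ∀ {m} → InjectiveBelow w₁ (suc a) → InjectiveBelow w₂ m
    → (∀ {s u} → s ≤ a → u < m → w₁ s ≡ w₂ u → u ≡ 0)
    → InjectiveBelow (w₁ ⟨ a ⟩++ w₂) (a + m)
  ++-injective {m} injective₁ injective₂ meet {i} {j} i< j< wi≡wj with split≤ a i | split≤ a j
  ... | inj₁ i≤a | inj₁ j≤a =
    injective₁ (s≤s i≤a) (s≤s j≤a) (trans (sym (++-left i≤a)) (trans wi≡wj (++-left j≤a)))
  ... | inj₁ i≤a | inj₂ (u , refl)
    with () ← meet i≤a (+-cancelˡ-< a (suc u) m j<) (trans (sym (++-left i≤a)) (trans wi≡wj (++-right-suc u)))
  ... | inj₂ (u , refl) | inj₁ j≤a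
    with () ← meet j≤a (+-cancelˡ-< a (suc u) m i<) (trans (sym (++-left j≤a)) (trans (sym wi≡wj) (++-right-suc u)))
  ... | inj₂ (u , refl) | inj₂ (u′ , refl) =
    cong (a +_) (injective₂ (+-cancelˡ-< a (suc u) m i<) (+-cancelˡ-< a (suc u′) m j<)
      (trans (sym (++-right-suc u)) (trans wi≡wj (++-right-suc u′))))

  visits-++ : ∀ {b v} → Visits (w₁ ⟨ a ⟩++ w₂) (a + b) v → Visits w₁ a v ⊎ Visits w₂ b v
  visits-++ {b} (t , t≤a+b , wt≡v) with split≤ a t
  ... | inj₁ t≤a = inj₁ (t , t≤a , trans (sym (++-left t≤a)) wt≡v)
  ... | inj₂ (u , refl) = inj₂ (suc u , +-cancelˡ-≤ a (suc u) b t≤a+b , trans (sym (++-right-suc u)) wt≡v)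

module _ {V : Set} {H : V → V → Set} where
  open IsPath

  ++-isPath : ∀ {w₁ w₂ a b} → IsPath H w₁ a → IsPath H w₂ b → w₁ a ≡ w₂ 0
    → (∀ {v} → Visits w₁ a v → Visits w₂ b v → v ≡ w₂ 0)
    → IsPath H (w₁ ⟨ a ⟩++ w₂) (a + b)
  ++-isPath {w₁} {w₂} {a} {b} path₁ path₂ junction meet = record
    { steps     = ++-steps {H = H} junction (steps path₁) (steps path₂)
    ; injective = subst (InjectiveBelow _) (+-suc a b)
                    (++-injective (injective path₁) (injective path₂) only-junction)
    }
    where
    only-junction : ∀ {s u} → s ≤ a → u < suc b → w₁ s ≡ w₂ u → u ≡ 0
    only-junction s≤a u<1+b ws≡wu =
      injective path₂ u<1+b (s≤s z≤n) (meet (_ , s≤a , ws≡wu) (_ , ≤-pred u<1+b , refl))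

  ++-isCycle : ∀ {w₁ w₂ a b} → IsPath H w₁ a → IsPath H w₂ b → w₁ a ≡ w₂ 0 → w₂ b ≡ w₁ 0
    → (∀ {v} → Visits w₁ a v → Visits w₂ b v → v ≡ w₁ 0 ⊎ v ≡ w₁ a)
    → IsCycle H (w₁ ⟨ a ⟩++ w₂) (a + b)
  ++-isCycle {w₁} {w₂} {a} {b} path₁ path₂ junction₁ junction₂ meet = record
    { steps     = ++-steps {H = H} junction₁ (steps path₁) (steps path₂)
    ; closed    = trans (++-right junction₁ b) (trans junction₂ (sym (++-left z≤n)))
    ; injective = ++-injective (injective path₁) injective₂ only-junction
    }
    where
    injective₂ : InjectiveBelow w₂ b
    injective₂ i<b j<b = injective path₂ (m<n⇒m<1+n i<b) (m<n⇒m<1+n j<b)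
    only-junction : ∀ {s u} → s ≤ a → u < b → w₁ s ≡ w₂ u → u ≡ 0
    only-junction s≤a u<b ws≡wu with meet (_ , s≤a , ws≡wu) (_ , <⇒≤ u<b , refl)
    ... | inj₁ wu≡w₁0 =
      ⊥-elim (<-irrefl (injective path₂ (m<n⇒m<1+n u<b) ≤-refl (trans wu≡w₁0 (sym junction₂))) u<b)
    ... | inj₂ wu≡w₁a = injective path₂ (m<n⇒m<1+n u<b) (s≤s z≤n) (trans wu≡w₁a junction₁)

  reverse-isPath : (∀ {x y} → H x y → H y x) → ∀ {w k} → IsPath H w k → IsPath H (reverse w k) k
  reverse-isPath H-sym {w} {k} path = record
    { steps     = λ {i} i<k → H-sym (subst (H (w (k ∸ suc i)) ∘ w) (sym (+-∸-assoc 1 i<k))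
                    (steps path (subst (_≤ k) (+-∸-assoc 1 i<k) (m∸n≤m k i))))
    ; injective = λ {i} {j} i<1+k j<1+k wk-i≡wk-j → ∸-cancelˡ-≡ (≤-pred i<1+k) (≤-pred j<1+k)
                    (injective path (s≤s (m∸n≤m k i)) (s≤s (m∸n≤m k j)) wk-i≡wk-j)
    }

visits-reverse : ∀ {V : Set} {w : ℕ → V} {k v} → Visits (reverse w k) k v → Visits w k v
visits-reverse {k = k} (t , _ , wk-t≡v) = k ∸ t , m∸n≤m k t , wk-t≡v

reverse-end : ∀ {V : Set} (w : ℕ → V) k → reverse w k k ≡ w 0
reverse-end w k = cong w (n∸n≡0 k)

module _ (G : Graph) where

  CycleOfLength : (V G → V G → Set) → ℕ → Set
  CycleOfLength H k = Σ[ D ∈ Cycle G ] len D ≡ k × (∀ u v → EdgeC G D u v → H u v)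

  toℕ-next : ∀ {k} .{{_ : NonZero k}} (i : Fin k) → toℕ (next G i) ≡ suc (toℕ i) % k
  toℕ-next {suc k} i = toℕ-fromℕ< _

  toCycle : ∀ {H w k} → (∀ {u v} → H u v → H v u) → (∀ {u v} → H u v → Adj G u v)
    → 3 ≤ k → IsCycle H w k → CycleOfLength H k
  toCycle {H} {w} {k} H-sym H⊆Adj 3≤k cycle = D , refl , edges
    where
    open IsCycle cycle
    instance
      k-nonZero : NonZero k
      k-nonZero = >-nonZero (<-≤-trans (s≤s z≤n) 3≤k)
    w-next : (i : Fin k) → w (toℕ (next G i)) ≡ w (suc (toℕ i))
    w-next i with m≤n⇒m<n∨m≡n (toℕ<n i)
    ... | inj₁ 1+i<k = cong w (trans (toℕ-next i) (m<n⇒m%n≡m 1+i<k))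
    ... | inj₂ 1+i≡k = begin
      w (toℕ (next G i))   ≡⟨ cong w (toℕ-next i) ⟩
      w (suc (toℕ i) % k)  ≡⟨ cong (λ j → w (j % k)) 1+i≡k ⟩
      w (k % k)            ≡⟨ cong w (n%n≡0 k) ⟩
      w 0                  ≡⟨ closed ⟨
      w k                  ≡⟨ cong w 1+i≡k ⟨
      w (suc (toℕ i))      ∎
      where open ≡-Reasoning
    step : (i : Fin k) → H (w (toℕ i)) (w (toℕ (next G i)))
    step i = subst (H (w (toℕ i))) (sym (w-next i)) (steps (toℕ<n i))
    D : Cycle G
    D = record { len = k ; 3≤len = 3≤k ; vert = w ∘ toℕ
               ; inj = toℕ-injective ∘ injective (toℕ<n _) (toℕ<n _) ; adj = H⊆Adj ∘ step }
    edges : ∀ u v → EdgeC G D u v → H u v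
    edges _ _ (i , inj₁ (refl , refl)) = step i
    edges _ _ (i , inj₂ (refl , refl)) = H-sym (step i)

  HasC4In-of : ∀ {H k} → CycleOfLength H k → 4 ∣ k → HasC4In G H
  HasC4In-of (D , refl , D⊆H) 4∣k = D , 4∣k , D⊆H

module _ {G : Graph} (C : Cycle G) where

  fwd<len : (i j : Fin (len C)) → fwd G C i j < len C
  fwd<len i j with len C
  ... | suc k = m%n<n (suc k + toℕ j ∸ toℕ i) (suc k)

  -- The instance is an argument so that `with len C` can abstract over it.
  fwd-mod : .{{_ : NonZero (len C)}} (i j : Fin (len C)) → (toℕ i + fwd G C i j) % len C ≡ toℕ j
  fwd-mod i j with len C
  ... | suc k = begin
    (toℕ i + (suc k + toℕ j ∸ toℕ i) % suc k) % suc k  ≡⟨ [m+n%d]%d≡[m+n]%d (toℕ i) _ (suc k) ⟩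
    (toℕ i + (suc k + toℕ j ∸ toℕ i)) % suc k          ≡⟨ cong (_% suc k) (m+[n∸m]≡n i≤k+j) ⟩
    (suc k + toℕ j) % suc k                            ≡⟨ cong (_% suc k) (+-comm (suc k) (toℕ j)) ⟩
    (toℕ j + suc k) % suc k                            ≡⟨ [m+n]%n≡m%n (toℕ j) (suc k) ⟩
    toℕ j % suc k                                      ≡⟨ m<n⇒m%n≡m (toℕ<n j) ⟩
    toℕ j                                              ∎
    where
    open ≡-Reasoning
    i≤k+j : toℕ i ≤ suc k + toℕ j
    i≤k+j = ≤-trans (<⇒≤ (toℕ<n i)) (m≤m+n (suc k) (toℕ j))

internal⇒onP : ∀ {G} P {v} → Internal G P v → OnP G P v
internal⇒onP _ (i , Pi≡v , _) = i , Pi≡v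

disjoint⇒IntDisjoint : ∀ {G} P Q → (∀ v → OnP G P v → ¬ OnP G Q v) → IntDisjoint G P Q
disjoint⇒IntDisjoint P Q P∩Q=∅ v =
  (λ internal → P∩Q=∅ v (internal⇒onP P internal)) , (λ internal v∈P → P∩Q=∅ v v∈P (internal⇒onP Q internal))

IntDisjoint-sym : ∀ {G} P Q → IntDisjoint G P Q → IntDisjoint G Q P
IntDisjoint-sym _ _ P∥Q v = proj₂ (P∥Q v) , proj₁ (P∥Q v)

EdgeC-sym : ∀ {G} C {u v} → EdgeC G C u v → EdgeC G C v u
EdgeC-sym _ (i , e) = i , swap e

EdgeP-sym : ∀ {G} P {u v} → EdgeP G P u v → EdgeP G P v u
EdgeP-sym _ (i , e) = i , swap e

EdgeC⇒Adj : ∀ {G} C {u v} → EdgeC G C u v → Adj G u v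
EdgeC⇒Adj {G} C (i , inj₁ (refl , refl)) = Cycle.adj C i
EdgeC⇒Adj {G} C (i , inj₂ (refl , refl)) = Graph.sym G (Cycle.adj C i)

EdgeP⇒Adj : ∀ {G} P {u v} → EdgeP G P u v → Adj G u v
EdgeP⇒Adj {G} P (i , inj₁ (refl , refl)) = Path.adj P i
EdgeP⇒Adj {G} P (i , inj₂ (refl , refl)) = Graph.sym G (Path.adj P i)

-- H is the edge set of the subgraph, containing C, in which the cycles are built.
module OnCycle (G : Graph) (C : Cycle G) {H : V G → V G → Set}
  (H-sym : ∀ {u v} → H u v → H v u) (H⊆Adj : ∀ {u v} → H u v → Adj G u v)
  (C⊆H : ∀ {u v} → EdgeC G C u v → H u v) where

  L : ℕ
  L = len C

  instance
    L-nonZero : NonZero L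
    L-nonZero = >-nonZero (<-≤-trans (s≤s z≤n) (3≤len C))

  at : ℕ → V G
  at z = vert C (z mod L)

  toℕ-mod : ∀ z → toℕ (z mod L) ≡ z % L
  toℕ-mod z = toℕ-fromℕ< _

  at-edge : ∀ z → EdgeC G C (at z) (at (suc z))
  at-edge z = z mod L , inj₁ (refl , cong (vert C) (toℕ-injective (begin
    toℕ (next G (z mod L))    ≡⟨ toℕ-next G (z mod L) ⟩
    suc (toℕ (z mod L)) % L   ≡⟨ cong (λ r → suc r % L) (toℕ-mod z) ⟩
    (1 + z % L) % L           ≡⟨ [m+n%d]%d≡[m+n]%d 1 z L ⟩
    suc z % L                 ≡⟨ toℕ-mod (suc z) ⟨
    toℕ (suc z mod L)         ∎)))
    where open ≡-Reasoning

  at-+L : ∀ z → at (z + L) ≡ at z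
  at-+L z = cong (vert C) (toℕ-injective (trans (toℕ-mod (z + L)) (trans ([m+n]%n≡m%n z L) (sym (toℕ-mod z)))))

  at-toℕ : ∀ i → at (toℕ i) ≡ vert C i
  at-toℕ i = cong (vert C) (toℕ-injective (trans (toℕ-mod (toℕ i)) (m<n⇒m%n≡m (toℕ<n i))))

  at-fwd : ∀ i j → at (toℕ i + fwd G C i j) ≡ vert C j
  at-fwd i j = cong (vert C) (toℕ-injective (trans (toℕ-mod _) (fwd-mod C i j)))

  at-injective : ∀ {y z} → y ≤ z → z < y + L → at y ≡ at z → y ≡ z
  at-injective {y} {z} y≤z z<y+L at-y≡at-z = begin
    y             ≡⟨ +-identityʳ y ⟨
    y + 0         ≡⟨ cong (y +_) z∸y≡0 ⟨
    y + (z ∸ y)   ≡⟨ m+[n∸m]≡n y≤z ⟩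
    z             ∎
    where
    open ≡-Reasoning
    z∸y<L : z ∸ y < L
    z∸y<L = subst (z ∸ y <_) (m+n∸m≡n y L) (∸-monoˡ-< z<y+L y≤z)
    z∸y≡0 : z ∸ y ≡ 0
    z∸y≡0 = [m+k]%n≡m⇒k≡0 (m%n<n y L) z∸y<L (begin
      (y % L + (z ∸ y)) % L   ≡⟨ cong (_% L) (+-comm (y % L) (z ∸ y)) ⟩
      (z ∸ y + y % L) % L     ≡⟨ [m+n%d]%d≡[m+n]%d (z ∸ y) y L ⟩
      (z ∸ y + y) % L         ≡⟨ cong (_% L) (m∸n+n≡m y≤z) ⟩
      z % L                   ≡⟨ toℕ-mod z ⟨
      toℕ (z mod L)           ≡⟨ cong toℕ (inj C at-y≡at-z) ⟨
      toℕ (y mod L)           ≡⟨ toℕ-mod y ⟩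
      y % L                   ∎)

  span<L : ∀ {p q} → p ≤ q → q < p + L → q ∸ p < L
  span<L {p} p≤q q<p+L = subst (_ <_) (m+n∸m≡n p L) (∸-monoˡ-< q<p+L p≤q)

  arc : ℕ → ℕ → V G
  arc p t = at (p + t)

  arc-start : ∀ p → arc p 0 ≡ at p
  arc-start p = cong at (+-identityʳ p)

  arc-end : ∀ {p q} → p ≤ q → arc p (q ∸ p) ≡ at q
  arc-end p≤q = cong at (m+[n∸m]≡n p≤q)

  reverse-arc-end : ∀ p m → reverse (arc p) m m ≡ at p
  reverse-arc-end p m = trans (reverse-end (arc p) m) (arc-start p)

  record PathOnC (R : ℕ → V G) (m : ℕ) : Set where
    field
      isPath : IsPath H R m
      onC    : ∀ {v} → Visits R m v → OnC G C v

  arc-pathOnC : ∀ p {m} → m < L → PathOnC (arc p) m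
  arc-pathOnC p {m} m<L = record
    { isPath = record { steps = step ; injective = injective }
    ; onC    = λ { (t , _ , at-p+t≡v) → (p + t) mod L , at-p+t≡v }
    }
    where
    step : Steps H (arc p) m
    step {i} _ = subst (H (arc p i) ∘ at) (sym (+-suc p i)) (C⊆H (at-edge (p + i)))
    ordered : ∀ {i j} → i ≤ j → j < suc m → arc p i ≡ arc p j → i ≡ j
    ordered {i} {j} i≤j j<1+m = +-cancelˡ-≡ p i j ∘ at-injective (+-monoʳ-≤ p i≤j)
      (<-≤-trans (+-monoʳ-< p (≤-<-trans (≤-pred j<1+m) m<L)) (+-monoˡ-≤ L (m≤m+n p i)))
    injective : InjectiveBelow (arc p) (suc m)
    injective {i} {j} i<1+m j<1+m with ≤-total i j
    ... | inj₁ i≤j = ordered i≤j j<1+m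
    ... | inj₂ j≤i = sym ∘ ordered j≤i i<1+m ∘ sym

  segment : ∀ {p q} → p ≤ q → q < p + L → PathOnC (arc p) (q ∸ p)
  segment {p} p≤q q<p+L = arc-pathOnC p (span<L p≤q q<p+L)

  segments-disjoint : ∀ {a b c d v} → a ≤ b → b < c → c ≤ d → d < a + L
    → Visits (arc a) (b ∸ a) v → Visits (arc c) (d ∸ c) v → ⊥
  segments-disjoint {a} {b} {c} {d} a≤b b<c c≤d d<a+L (s , s≤b-a , at-a+s≡v) (t , t≤d-c , at-c+t≡v) =
    <-irrefl (at-injective (<⇒≤ a+s<c+t) c+t<a+s+L (trans at-a+s≡v (sym at-c+t≡v))) a+s<c+t
    where
    a+s≤b : a + s ≤ b
    a+s≤b = subst (a + s ≤_) (m+[n∸m]≡n a≤b) (+-monoʳ-≤ a s≤b-a)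
    c+t≤d : c + t ≤ d
    c+t≤d = subst (c + t ≤_) (m+[n∸m]≡n c≤d) (+-monoʳ-≤ c t≤d-c)
    a+s<c+t : a + s < c + t
    a+s<c+t = <-≤-trans (≤-<-trans a+s≤b b<c) (m≤m+n c t)
    c+t<a+s+L : c + t < a + s + L
    c+t<a+s+L = <-≤-trans (≤-<-trans c+t≤d d<a+L) (+-monoˡ-≤ L (m≤m+n a s))

  reverse-pathOnC : ∀ {R m} → PathOnC R m → PathOnC (reverse R m) m
  reverse-pathOnC R = record { isPath = reverse-isPath H-sym (isPath R) ; onC = onC R ∘ visits-reverse }
    where open PathOnC

  -- Bridges and cycles through them

  internal∉C : ∀ P {v} → Bridge G C P → Internal G P v → OnC G C v → ⊥
  internal∉C P (_ , _ , ends) (i , Pi≡v , 0<i , i<len) v∈C with proj₁ (ends _) ((i , Pi≡v) , v∈C)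
  ... | inj₁ v≡start = <-irrefl (cong toℕ (sym (Path.inj P (trans Pi≡v v≡start)))) 0<i
  ... | inj₂ v≡end = <-irrefl (trans (cong toℕ (Path.inj P (trans Pi≡v v≡end))) (toℕ-fromℕ (Path.len P))) i<len

  record Traversal (P : Path G) (p q : ℕ) : Set where
    field
      bridge          : Bridge G C P
      walk            : ℕ → V G
      isPath          : IsPath H walk (Path.len P)
      starts-at       : walk 0 ≡ at p
      ends-at         : walk (Path.len P) ≡ at q
      onP             : ∀ {v} → Visits walk (Path.len P) v → OnP G P v
      end-or-internal : ∀ {v} → Visits walk (Path.len P) v → v ≡ at p ⊎ v ≡ at q ⊎ Internal G P v

  traverse : ∀ {P p q} → Bridge G C P → (∀ {u v} → EdgeP G P u v → H u v)
    → at p ≡ start G P → at q ≡ end G P → Traversal P p q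
  traverse {P} {p} {q} bridge P⊆H at-p≡start at-q≡end = record
    { bridge          = bridge
    ; walk            = walk
    ; isPath          = record { steps = step ; injective = injective }
    ; starts-at       = sym at-p≡start
    ; ends-at         = trans walk-l (sym at-q≡end)
    ; onP             = λ { (t , _ , walk-t≡v) → t mod suc l , walk-t≡v }
    ; end-or-internal = end-or-internal
    }
    where
    l = Path.len P
    walk : ℕ → V G
    walk t = Path.vert P (t mod suc l)
    toℕ-walk : ∀ {t} → t ≤ l → toℕ (t mod suc l) ≡ t
    toℕ-walk t≤l = trans (toℕ-fromℕ< _) (m≤n⇒m%n≡m t≤l)
    walk-l : walk l ≡ end G P
    walk-l = cong (Path.vert P) (toℕ-injective (trans (toℕ-walk ≤-refl) (sym (toℕ-fromℕ l))))
    step : Steps H walk l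
    step {i} i<l = P⊆H (fromℕ< i<l , inj₁ (cong (Path.vert P) (toℕ-injective (begin
        toℕ (inject₁ (fromℕ< i<l))  ≡⟨ toℕ-inject₁ _ ⟩
        toℕ (fromℕ< i<l)            ≡⟨ toℕ-fromℕ< i<l ⟩
        i                           ≡⟨ toℕ-walk (<⇒≤ i<l) ⟨
        toℕ (i mod suc l)           ∎))
      , cong (Path.vert P) (toℕ-injective (trans (cong suc (toℕ-fromℕ< i<l)) (sym (toℕ-walk i<l))))))
      where open ≡-Reasoning
    injective : InjectiveBelow walk (suc l)
    injective {i} {j} i<1+l j<1+l walk-i≡walk-j =
      trans (sym (toℕ-walk (≤-pred i<1+l))) (trans (cong toℕ (Path.inj P walk-i≡walk-j)) (toℕ-walk (≤-pred j<1+l)))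
    end-or-internal : ∀ {v} → Visits walk l v → v ≡ at p ⊎ v ≡ at q ⊎ Internal G P v
    end-or-internal {v} (zero , _ , walk-0≡v) = inj₁ (trans (sym walk-0≡v) (sym at-p≡start))
    end-or-internal {v} (suc t , 1+t≤l , walk-t≡v) with m≤n⇒m<n∨m≡n 1+t≤l
    ... | inj₁ 1+t<l = inj₂ (inj₂ (suc t mod suc l , walk-t≡v
                                   , subst (0 <_) (sym (toℕ-walk 1+t≤l)) (s≤s z≤n)
                                   , subst (_< l) (sym (toℕ-walk 1+t≤l)) 1+t<l))
    ... | inj₂ refl  = inj₂ (inj₁ (trans (sym walk-t≡v) (trans walk-l (sym at-q≡end))))

  reverse-traversal : ∀ {P p q} → Traversal P p q → Traversal P q p
  reverse-traversal {P} T = record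
    { bridge          = bridge
    ; walk            = reverse walk (Path.len P)
    ; isPath          = reverse-isPath H-sym isPath
    ; starts-at       = ends-at
    ; ends-at         = trans (reverse-end walk (Path.len P)) starts-at
    ; onP             = onP ∘ visits-reverse
    ; end-or-internal = swap-ends ∘ end-or-internal ∘ visits-reverse
    }
    where
    open Traversal T
    swap-ends : ∀ {A B X : Set} → A ⊎ B ⊎ X → B ⊎ A ⊎ X
    swap-ends (inj₁ a)        = inj₂ (inj₁ a)
    swap-ends (inj₂ (inj₁ b)) = inj₁ b
    swap-ends (inj₂ (inj₂ x)) = inj₂ (inj₂ x)

  traversal-ends-distinct : ∀ {P p q} → Traversal P p q → at p ≡ at q → ⊥
  traversal-ends-distinct {P} T at-p≡at-q =
    <-irrefl (IsPath.injective isPath (s≤s z≤n) ≤-refl (trans starts-at (trans at-p≡at-q (sym ends-at))))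
             (proj₁ bridge)
    where open Traversal T

  traverse-ends : ∀ {P p q x y} → Bridge G C P → (∀ {u v} → EdgeP G P u v → H u v)
    → Ends G P x y → at p ≡ x → at q ≡ y → Traversal P p q
  traverse-ends bridge P⊆H (inj₁ (x≡start , y≡end)) at-p≡x at-q≡y =
    traverse bridge P⊆H (trans at-p≡x x≡start) (trans at-q≡y y≡end)
  traverse-ends bridge P⊆H (inj₂ (x≡end , y≡start)) at-p≡x at-q≡y =
    reverse-traversal (traverse bridge P⊆H (trans at-q≡y y≡start) (trans at-p≡x x≡end))

  module _ {P p q} (T : Traversal P p q) where
    open Traversal T

    onC⇒end : ∀ {v} → Visits walk (Path.len P) v → OnC G C v → v ≡ at p ⊎ v ≡ at q
    onC⇒end v∈walk v∈C with end-or-internal v∈walk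
    ... | inj₁ v≡at-p          = inj₁ v≡at-p
    ... | inj₂ (inj₁ v≡at-q)   = inj₂ v≡at-q
    ... | inj₂ (inj₂ internal) = ⊥-elim (internal∉C P bridge internal v∈C)

    ++-arc-isPath : ∀ {R m} → PathOnC R m → R 0 ≡ at q → (Visits R m (at p) → ⊥)
      → IsPath H (walk ⟨ Path.len P ⟩++ R) (Path.len P + m)
    ++-arc-isPath {R} R-onC R-starts at-p∉R =
      ++-isPath isPath (PathOnC.isPath R-onC) (trans ends-at (sym R-starts)) meet
      where
      meet : ∀ {v} → Visits walk (Path.len P) v → Visits R _ v → v ≡ R 0
      meet v∈walk v∈R with onC⇒end v∈walk (PathOnC.onC R-onC v∈R)
      ... | inj₁ refl   = ⊥-elim (at-p∉R v∈R)
      ... | inj₂ v≡at-q = trans v≡at-q (sym R-starts)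

    visits-++-arc : ∀ {R m v} → R 0 ≡ at q → Visits (walk ⟨ Path.len P ⟩++ R) (Path.len P + m) v
      → v ≡ at p ⊎ Internal G P v ⊎ Visits R m v
    visits-++-arc R-starts v∈walk++R with visits-++ v∈walk++R
    ... | inj₂ v∈R = inj₂ (inj₂ v∈R)
    ... | inj₁ v∈walk with end-or-internal v∈walk
    ...   | inj₁ v≡at-p          = inj₁ v≡at-p
    ...   | inj₂ (inj₁ v≡at-q)   = inj₂ (inj₂ (0 , z≤n , trans R-starts (sym v≡at-q)))
    ...   | inj₂ (inj₂ internal) = inj₂ (inj₁ internal)

  bridge-arc-cycle : ∀ {P p q R m} → Traversal P p q → 2 ≤ Path.len P → PathOnC R m → 1 ≤ m
    → R 0 ≡ at q → R m ≡ at p → CycleOfLength G H (Path.len P + m)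
  bridge-arc-cycle {P} T 2≤l R-onC 1≤m R-starts R-ends = toCycle G H-sym H⊆Adj (+-mono-≤ 2≤l 1≤m)
    (++-isCycle isPath (PathOnC.isPath R-onC) (trans ends-at (sym R-starts)) (trans R-ends (sym starts-at)) meet)
    where
    open Traversal T
    meet : ∀ {v} → Visits walk (Path.len P) v → Visits _ _ v → v ≡ walk 0 ⊎ v ≡ walk (Path.len P)
    meet v∈walk v∈R with onC⇒end T v∈walk (PathOnC.onC R-onC v∈R)
    ... | inj₁ v≡at-p = inj₁ (trans v≡at-p (sym starts-at))
    ... | inj₂ v≡at-q = inj₂ (trans v≡at-q (sym ends-at))

  bridges-arcs-cycle : ∀ {P₁ p₁ q₁ P₂ p₂ q₂ R₁ m₁ R₂ m₂}
    → Traversal P₁ p₁ q₁ → Traversal P₂ p₂ q₂ → 2 ≤ Path.len P₁ → IntDisjoint G P₁ P₂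
    → PathOnC R₁ m₁ → PathOnC R₂ m₂ → (∀ {v} → Visits R₁ m₁ v → Visits R₂ m₂ v → ⊥)
    → R₁ 0 ≡ at q₁ → R₁ m₁ ≡ at p₂ → R₂ 0 ≡ at q₂ → R₂ m₂ ≡ at p₁
    → CycleOfLength G H ((Path.len P₁ + m₁) + (Path.len P₂ + m₂))
  bridges-arcs-cycle {P₁} {p₁} {q₁} {P₂} {p₂} {q₂} {R₁} {m₁} {R₂} {m₂}
    T₁ T₂ 2≤l₁ P₁∥P₂ R₁-onC R₂-onC R₁∩R₂=∅ R₁-starts R₁-ends R₂-starts R₂-ends =
    toCycle G H-sym H⊆Adj 3≤length (++-isCycle A-path B-path A-ends B-ends meet)
    where
    module T₁ = Traversal T₁
    module T₂ = Traversal T₂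
    l₁ = Path.len P₁
    l₂ = Path.len P₂
    A = T₁.walk ⟨ l₁ ⟩++ R₁
    B = T₂.walk ⟨ l₂ ⟩++ R₂
    A-path : IsPath H A (l₁ + m₁)
    A-path = ++-arc-isPath T₁ R₁-onC R₁-starts (λ at-p₁∈R₁ → R₁∩R₂=∅ at-p₁∈R₁ (m₂ , ≤-refl , R₂-ends))
    B-path : IsPath H B (l₂ + m₂)
    B-path = ++-arc-isPath T₂ R₂-onC R₂-starts (R₁∩R₂=∅ (m₁ , ≤-refl , R₁-ends))
    A-starts : A 0 ≡ at p₁
    A-starts = trans (++-left z≤n) T₁.starts-at
    B-starts : B 0 ≡ at p₂
    B-starts = trans (++-left z≤n) T₂.starts-at
    A-ends : A (l₁ + m₁) ≡ B 0
    A-ends = trans (++-right (trans T₁.ends-at (sym R₁-starts)) m₁) (trans R₁-ends (sym B-starts))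
    B-ends : B (l₂ + m₂) ≡ A 0
    B-ends = trans (++-right (trans T₂.ends-at (sym R₂-starts)) m₂) (trans R₂-ends (sym A-starts))
    meet : ∀ {v} → Visits A (l₁ + m₁) v → Visits B (l₂ + m₂) v → v ≡ A 0 ⊎ v ≡ A (l₁ + m₁)
    meet v∈A v∈B with visits-++-arc T₁ R₁-starts v∈A | visits-++-arc T₂ R₂-starts v∈B
    ... | inj₁ v≡at-p₁ | _ = inj₁ (trans v≡at-p₁ (sym A-starts))
    ... | _ | inj₁ v≡at-p₂ = inj₂ (trans v≡at-p₂ (sym (trans A-ends B-starts)))
    ... | inj₂ (inj₁ internal₁) | inj₂ (inj₁ internal₂) =
      ⊥-elim (proj₁ (P₁∥P₂ _) internal₁ (internal⇒onP P₂ internal₂))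
    ... | inj₂ (inj₁ internal₁) | inj₂ (inj₂ v∈R₂) =
      ⊥-elim (internal∉C P₁ T₁.bridge internal₁ (PathOnC.onC R₂-onC v∈R₂))
    ... | inj₂ (inj₂ v∈R₁) | inj₂ (inj₁ internal₂) =
      ⊥-elim (internal∉C P₂ T₂.bridge internal₂ (PathOnC.onC R₁-onC v∈R₁))
    ... | inj₂ (inj₂ v∈R₁) | inj₂ (inj₂ v∈R₂) = ⊥-elim (R₁∩R₂=∅ v∈R₁ v∈R₂)
    3≤length : 3 ≤ (l₁ + m₁) + (l₂ + m₂)
    3≤length = +-mono-≤ (≤-trans 2≤l₁ (m≤m+n l₁ m₁)) (≤-trans (proj₁ T₂.bridge) (m≤m+n l₂ m₂))

  -- Cycles of length divisible by 4 when L ≡ 2 (mod 4), which is written 4 ∣ L + 2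

  module _ (4∣L+2 : 4 ∣ L + 2) where

    open Traversal using (bridge)

    2≤len : ∀ {P p q} → Traversal P p q → 2 ∣ Path.len P → 2 ≤ Path.len P
    2≤len T = even⇒2≤ (proj₁ (bridge T))

    even-span⇒C4 : ∀ {P p q} → Traversal P p q → 2 ∣ Path.len P → p < q → q < p + L → 2 ∣ q ∸ p
      → HasC4In G H
    even-span⇒C4 {P} {p} {q} T 2∣l p<q q<p+L 2∣d =
      [ HasC4In-of G via-[p,q] , HasC4In-of G via-[q,p+L] ]′ (even-span-mod4 2∣l 2∣d 4∣d+e+2)
      where
      via-[p,q] : CycleOfLength G H (Path.len P + (q ∸ p))
      via-[p,q] = bridge-arc-cycle (reverse-traversal T) (2≤len T 2∣l) (segment (<⇒≤ p<q) q<p+L)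
        (m<n⇒0<n∸m p<q) (arc-start p) (arc-end (<⇒≤ p<q))
      via-[q,p+L] : CycleOfLength G H (Path.len P + (p + L ∸ q))
      via-[q,p+L] = bridge-arc-cycle T (2≤len T 2∣l) (segment (<⇒≤ q<p+L) (+-monoˡ-< L p<q))
        (m<n⇒0<n∸m q<p+L) (arc-start q) (trans (arc-end (<⇒≤ q<p+L)) (at-+L p))
      4∣d+e+2 : 4 ∣ (q ∸ p) + (p + L ∸ q) + 2
      4∣d+e+2 = ∣-respʳ (cong (_+ 2) (sym (trans (∸-telescope (<⇒≤ p<q) (<⇒≤ q<p+L)) (m+n∸m≡n p L)))) 4∣L+2

    odd-crossing⇒C4 : ∀ {P₁ p₁ q₁ P₂ p₂ q₂} → Traversal P₁ p₁ q₁ → Traversal P₂ p₂ q₂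
      → 2 ∣ Path.len P₁ → 2 ∣ Path.len P₂ → IntDisjoint G P₁ P₂
      → p₁ < p₂ → p₂ < q₁ → q₁ < q₂ → q₂ < p₁ + L → ¬ 2 ∣ q₁ ∸ p₁ → ¬ 2 ∣ q₂ ∸ p₂ → HasC4In G H
    odd-crossing⇒C4 {P₁} {p₁} {q₁} {P₂} {p₂} {q₂} T₁ T₂ 2∣l₁ 2∣l₂ P₁∥P₂ p₁<p₂ p₂<q₁ q₁<q₂ q₂<p₁+L ¬2∣d₁ ¬2∣d₂ =
      [ HasC4In-of G via-[q₁,q₂]-[p₁,p₂] , HasC4In-of G via-[p₂,q₁]-[q₂,p₁+L] ]′
        (crossing-mod4 2∣l₁ 2∣l₂ (¬2∣d₁ ∘ ∣-respʳ a+b≡d₁) (¬2∣d₂ ∘ ∣-respʳ b+c≡d₂) 4∣a+b+c+d+2)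
      where
      p₁≤p₂ = <⇒≤ p₁<p₂
      p₂≤q₁ = <⇒≤ p₂<q₁
      q₁≤q₂ = <⇒≤ q₁<q₂
      q₂≤p₁+L = <⇒≤ q₂<p₁+L
      via-[q₁,q₂]-[p₁,p₂] : CycleOfLength G H ((Path.len P₁ + (q₂ ∸ q₁)) + (Path.len P₂ + (p₂ ∸ p₁)))
      via-[q₁,q₂]-[p₁,p₂] = bridges-arcs-cycle T₁ (reverse-traversal T₂) (2≤len T₁ 2∣l₁) P₁∥P₂
        (segment q₁≤q₂ (<-≤-trans q₂<p₁+L (+-monoˡ-≤ L (≤-trans p₁≤p₂ p₂≤q₁))))
        (reverse-pathOnC (segment p₁≤p₂ (<-trans (<-trans p₂<q₁ q₁<q₂) q₂<p₁+L)))
        (λ v∈R₁ v∈R₂ → segments-disjoint p₁≤p₂ p₂<q₁ q₁≤q₂ q₂<p₁+L (visits-reverse v∈R₂) v∈R₁)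
        (arc-start q₁) (arc-end q₁≤q₂) (arc-end p₁≤p₂) (reverse-arc-end p₁ (p₂ ∸ p₁))
      via-[p₂,q₁]-[q₂,p₁+L] : CycleOfLength G H ((Path.len P₁ + (q₁ ∸ p₂)) + (Path.len P₂ + (p₁ + L ∸ q₂)))
      via-[p₂,q₁]-[q₂,p₁+L] = bridges-arcs-cycle T₁ T₂ (2≤len T₁ 2∣l₁) P₁∥P₂
        (reverse-pathOnC (segment p₂≤q₁ (<-trans q₁<q₂ (<-≤-trans q₂<p₁+L (+-monoˡ-≤ L p₁≤p₂)))))
        (segment q₂≤p₁+L (+-monoˡ-< L (<-trans p₁<p₂ (<-trans p₂<q₁ q₁<q₂))))
        (λ v∈R₁ v∈R₂ → segments-disjoint p₂≤q₁ q₁<q₂ q₂≤p₁+L (+-monoˡ-< L p₁<p₂) (visits-reverse v∈R₁) v∈R₂)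
        (arc-end p₂≤q₁) (reverse-arc-end p₂ (q₁ ∸ p₂)) (arc-start q₂) (trans (arc-end q₂≤p₁+L) (at-+L p₁))
      a+b≡d₁ : (p₂ ∸ p₁) + (q₁ ∸ p₂) ≡ q₁ ∸ p₁
      a+b≡d₁ = ∸-telescope p₁≤p₂ p₂≤q₁
      b+c≡d₂ : (q₁ ∸ p₂) + (q₂ ∸ q₁) ≡ q₂ ∸ p₂
      b+c≡d₂ = ∸-telescope p₂≤q₁ q₁≤q₂
      4∣a+b+c+d+2 : 4 ∣ (p₂ ∸ p₁) + (q₁ ∸ p₂) + (q₂ ∸ q₁) + (p₁ + L ∸ q₂) + 2
      4∣a+b+c+d+2 = ∣-respʳ (cong (_+ 2) (sym (trans (∸-telescope₄ p₁≤p₂ p₂≤q₁ q₁≤q₂ q₂≤p₁+L) (m+n∸m≡n p₁ L))))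
        4∣L+2

    crossing⇒C4 : ∀ {P₁ p₁ q₁ P₂ p₂ q₂} → Traversal P₁ p₁ q₁ → Traversal P₂ p₂ q₂
      → 2 ∣ Path.len P₁ → 2 ∣ Path.len P₂ → IntDisjoint G P₁ P₂
      → p₁ < p₂ → p₂ < q₁ → q₁ < q₂ → q₂ < p₁ + L → HasC4In G H
    crossing⇒C4 {p₁ = p₁} {q₁} {p₂ = p₂} {q₂} T₁ T₂ 2∣l₁ 2∣l₂ P₁∥P₂ p₁<p₂ p₂<q₁ q₁<q₂ q₂<p₁+L
      with 2 ∣? q₁ ∸ p₁ | 2 ∣? q₂ ∸ p₂
    ... | yes 2∣d₁ | _ = even-span⇒C4 T₁ 2∣l₁ (<-trans p₁<p₂ p₂<q₁) (<-trans q₁<q₂ q₂<p₁+L) 2∣d₁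
    ... | _ | yes 2∣d₂ =
      even-span⇒C4 T₂ 2∣l₂ (<-trans p₂<q₁ q₁<q₂) (<-≤-trans q₂<p₁+L (+-monoˡ-≤ L (<⇒≤ p₁<p₂))) 2∣d₂
    ... | no ¬2∣d₁ | no ¬2∣d₂ =
      odd-crossing⇒C4 T₁ T₂ 2∣l₁ 2∣l₂ P₁∥P₂ p₁<p₂ p₂<q₁ q₁<q₂ q₂<p₁+L ¬2∣d₁ ¬2∣d₂

    nested⇒C4 : ∀ {P p q Q p′ q′} → Traversal P p q → Traversal Q p′ q′
      → 2 ∣ Path.len P → IntDisjoint G P Q → p ≤ p′ → p′ < q′ → q′ ≤ q → q < p + L → ¬ 2 ∣ q′ ∸ p′
      → 4 ∣ (Path.len P + (q ∸ p)) + (Path.len Q + (q′ ∸ p′)) + 2 → HasC4In G H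
    nested⇒C4 {P} {p} {q} {Q} {p′} {q′} T T′ 2∣l P∥Q p≤p′ p′<q′ q′≤q q<p+L ¬2∣d′ 4∣τ+τ′+2 =
      HasC4In-of G via-[p,p′]-[q′,q] (nested-mod4 {Path.len P} {Path.len Q} ¬2∣d′ (∣-respʳ τ≡ 4∣τ+τ′+2))
      where
      via-[p,p′]-[q′,q] : CycleOfLength G H ((Path.len P + (p′ ∸ p)) + (Path.len Q + (q ∸ q′)))
      via-[p,p′]-[q′,q] = bridges-arcs-cycle (reverse-traversal T) T′ (2≤len T 2∣l) P∥Q
        (segment p≤p′ (<-trans p′<q′ (≤-<-trans q′≤q q<p+L)))
        (segment q′≤q (<-≤-trans q<p+L (+-monoˡ-≤ L (≤-trans p≤p′ (<⇒≤ p′<q′)))))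
        (segments-disjoint p≤p′ p′<q′ q′≤q q<p+L)
        (arc-start p) (arc-end p≤p′) (arc-start q′) (arc-end q′≤q)
      τ≡ : (Path.len P + (q ∸ p)) + (Path.len Q + (q′ ∸ p′)) + 2
         ≡ (Path.len P + ((p′ ∸ p) + (q′ ∸ p′) + (q ∸ q′))) + (Path.len Q + (q′ ∸ p′)) + 2
      τ≡ = cong (λ d → Path.len P + d + (Path.len Q + (q′ ∸ p′)) + 2) (sym (∸-telescope₃ p≤p′ (<⇒≤ p′<q′) q′≤q))

    separated⇒C4 : ∀ {P₁ p₁ q₁ P₂ p₂ q₂} → Traversal P₁ p₁ q₁ → Traversal P₂ p₂ q₂
      → 2 ∣ Path.len P₁ → IntDisjoint G P₁ P₂ → p₁ < q₁ → q₁ ≤ p₂ → p₂ < q₂ → q₂ < p₁ + L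
      → ¬ 2 ∣ q₁ ∸ p₁ → ¬ 2 ∣ q₂ ∸ p₂ → 4 ∣ (Path.len P₁ + (q₁ ∸ p₁)) + (Path.len P₂ + (q₂ ∸ p₂)) + 2
      → HasC4In G H
    separated⇒C4 {P₁} {p₁} {q₁} {P₂} {p₂} {q₂} T₁ T₂ 2∣l₁ P₁∥P₂ p₁<q₁ q₁≤p₂ p₂<q₂ q₂<p₁+L ¬2∣d₁ ¬2∣d₂ 4∣τ₁+τ₂+2 =
      HasC4In-of G via-[q₁,p₂]-[q₂,p₁+L]
        (separated-mod4 {Path.len P₁} {Path.len P₂} ¬2∣d₁ ¬2∣d₂ 4∣τ₁+τ₂+2 4∣d₁+e₁+d₂+e₂+2)
      where
      via-[q₁,p₂]-[q₂,p₁+L] : CycleOfLength G H ((Path.len P₁ + (p₂ ∸ q₁)) + (Path.len P₂ + (p₁ + L ∸ q₂)))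
      via-[q₁,p₂]-[q₂,p₁+L] = bridges-arcs-cycle T₁ T₂ (2≤len T₁ 2∣l₁) P₁∥P₂
        (segment q₁≤p₂ (<-trans p₂<q₂ (<-≤-trans q₂<p₁+L (+-monoˡ-≤ L (<⇒≤ p₁<q₁)))))
        (segment (<⇒≤ q₂<p₁+L) (+-monoˡ-< L (<-≤-trans p₁<q₁ (≤-trans q₁≤p₂ (<⇒≤ p₂<q₂)))))
        (segments-disjoint q₁≤p₂ p₂<q₂ (<⇒≤ q₂<p₁+L) (+-monoˡ-< L p₁<q₁))
        (arc-start q₁) (arc-end q₁≤p₂) (arc-start q₂) (trans (arc-end (<⇒≤ q₂<p₁+L)) (at-+L p₁))
      4∣d₁+e₁+d₂+e₂+2 : 4 ∣ (q₁ ∸ p₁) + (p₂ ∸ q₁) + (q₂ ∸ p₂) + (p₁ + L ∸ q₂) + 2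
      4∣d₁+e₁+d₂+e₂+2 = ∣-respʳ (cong (_+ 2) (sym (trans
        (∸-telescope₄ (<⇒≤ p₁<q₁) q₁≤p₂ (<⇒≤ p₂<q₂) (<⇒≤ q₂<p₁+L)) (m+n∸m≡n p₁ L)))) 4∣L+2

    fwd-even⇒C4 : ∀ P → Bridge G C P → (∀ {u v} → EdgeP G P u v → H u v) → 2 ∣ Path.len P
      → ∀ i j → Ends G P (vert C i) (vert C j) → 2 ∣ fwd G C i j → HasC4In G H
    fwd-even⇒C4 P bridge P⊆H 2∣l i j ends 2∣f =
      even-span⇒C4 Tᵢⱼ 2∣l (m<m+n (toℕ i) 0<f) (+-monoʳ-< (toℕ i) (fwd<len C i j))
        (∣-respʳ (sym (m+n∸m≡n (toℕ i) (fwd G C i j))) 2∣f)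
      where
      Tᵢⱼ : Traversal P (toℕ i) (toℕ i + fwd G C i j)
      Tᵢⱼ = traverse-ends bridge P⊆H ends (at-toℕ i) (at-fwd i j)
      0<f : 0 < fwd G C i j
      0<f = n≢0⇒n>0 λ f≡0 → traversal-ends-distinct Tᵢⱼ
        (trans (cong at (sym (+-identityʳ (toℕ i)))) (cong (λ f → at (toℕ i + f)) (sym f≡0)))

    span-even⇒C4 : ∀ P → Bridge G C P → (∀ {u v} → EdgeP G P u v → H u v) → 2 ∣ Path.len P
      → ∃[ s ] (SpanIs G C P s × 2 ∣ s) → HasC4In G H
    span-even⇒C4 P bridge P⊆H 2∣l (s , (i , j , i↦start , j↦end , s≡min) , 2∣s)
      with ⊓-sel (fwd G C i j) (fwd G C j i)
    ... | inj₁ min≡fwd-ij =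
      fwd-even⇒C4 P bridge P⊆H 2∣l i j (inj₁ (i↦start , j↦end)) (∣-respʳ (trans s≡min min≡fwd-ij) 2∣s)
    ... | inj₂ min≡fwd-ji =
      fwd-even⇒C4 P bridge P⊆H 2∣l j i (inj₂ (j↦end , i↦start)) (∣-respʳ (trans s≡min min≡fwd-ji) 2∣s)

    crossed⇒C4 : ∀ P₁ P₂ → Bridge G C P₁ → Bridge G C P₂
      → (∀ {u v} → EdgeP G P₁ u v → H u v) → (∀ {u v} → EdgeP G P₂ u v → H u v)
      → 2 ∣ Path.len P₁ → 2 ∣ Path.len P₂ → Crossed G C P₁ P₂ → HasC4In G H
    crossed⇒C4 P₁ P₂ B₁ B₂ P₁⊆H P₂⊆H 2∣l₁ 2∣l₂
      (P₁∩P₂=∅ , _ , _ , _ , _ , ends₁ , ends₂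
      , i₁ , i₂ , i₃ , i₄ , i₁↦x₁ , i₂↦x₂ , i₃↦y₁ , i₄↦y₂ , 0<f₂ , f₂<f₃ , f₃<f₄) =
      crossing⇒C4 (traverse-ends {P₁} B₁ P₁⊆H ends₁ (trans (at-toℕ i₁) i₁↦x₁) (trans (at-fwd i₁ i₃) i₃↦y₁))
                  (traverse-ends {P₂} B₂ P₂⊆H ends₂ (trans (at-fwd i₁ i₂) i₂↦x₂) (trans (at-fwd i₁ i₄) i₄↦y₂))
                  2∣l₁ 2∣l₂ (disjoint⇒IntDisjoint P₁ P₂ P₁∩P₂=∅)
                  (m<m+n (toℕ i₁) 0<f₂) (+-monoʳ-< (toℕ i₁) f₂<f₃) (+-monoʳ-< (toℕ i₁) f₃<f₄)
                  (+-monoʳ-< (toℕ i₁) (fwd<len C i₁ i₄))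

    record Placed (P : Path G) : Set where
      field
        p q       : ℕ
        p<q       : p < q
        q<L       : q < L
        traversal : Traversal P p q

      span : ℕ
      span = q ∸ p

    open Placed using (span)

    place : ∀ {P a b} → Traversal P a b → a < L → b < L → Placed P
    place {a = a} {b} T a<L b<L with <-cmp a b
    ... | tri< a<b _ _ = record { p = a ; q = b ; p<q = a<b ; q<L = b<L ; traversal = T }
    ... | tri≈ _ a≡b _ = ⊥-elim (traversal-ends-distinct T (cong at a≡b))
    ... | tri> _ _ b<a = record { p = b ; q = a ; p<q = b<a ; q<L = a<L ; traversal = reverse-traversal T }

    placed : ∀ P → Bridge G C P → (∀ {u v} → EdgeP G P u v → H u v) → Placed P
    placed P bridge P⊆H with proj₂ (proj₂ (proj₂ (proj₂ bridge) (start G P)) (inj₁ refl))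
                             | proj₂ (proj₂ (proj₂ (proj₂ bridge) (end G P)) (inj₂ refl))
    ... | i , i↦start | j , j↦end =
      place (traverse bridge P⊆H (trans (at-toℕ i) i↦start) (trans (at-toℕ j) j↦end)) (toℕ<n i) (toℕ<n j)

    placed-even-span⇒C4 : ∀ {P} (X : Placed P) → 2 ∣ Path.len P → 2 ∣ span X → HasC4In G H
    placed-even-span⇒C4 X 2∣l = even-span⇒C4 traversal 2∣l p<q (<-≤-trans q<L (m≤n+m L p))
      where open Placed X

    -- Separated, Q nested in P, crossing, or (when p₁ = p₂) P nested in Q.
    ordered-odd-pair⇒C4 : ∀ {P p₁ q₁ Q p₂ q₂} → Traversal P p₁ q₁ → Traversal Q p₂ q₂
      → 2 ∣ Path.len P → 2 ∣ Path.len Q → IntDisjoint G P Q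
      → p₁ ≤ p₂ → p₁ < q₁ → p₂ < q₂ → q₁ < L → q₂ < L → ¬ 2 ∣ q₁ ∸ p₁ → ¬ 2 ∣ q₂ ∸ p₂
      → 4 ∣ (Path.len P + (q₁ ∸ p₁)) + (Path.len Q + (q₂ ∸ p₂)) + 2 → HasC4In G H
    ordered-odd-pair⇒C4 {P} {p₁} {q₁} {Q} {p₂} {q₂}
      T₁ T₂ 2∣l₁ 2∣l₂ P∥Q p₁≤p₂ p₁<q₁ p₂<q₂ q₁<L q₂<L ¬2∣d₁ ¬2∣d₂ 4∣τ₁+τ₂+2
      with q₁ ≤? p₂ | q₂ ≤? q₁ | m≤n⇒m<n∨m≡n p₁≤p₂
    ... | yes q₁≤p₂ | _ | _ =
      separated⇒C4 T₁ T₂ 2∣l₁ P∥Q p₁<q₁ q₁≤p₂ p₂<q₂ (<-≤-trans q₂<L (m≤n+m L p₁)) ¬2∣d₁ ¬2∣d₂ 4∣τ₁+τ₂+2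
    ... | no _ | yes q₂≤q₁ | _ =
      nested⇒C4 T₁ T₂ 2∣l₁ P∥Q p₁≤p₂ p₂<q₂ q₂≤q₁ (<-≤-trans q₁<L (m≤n+m L p₁)) ¬2∣d₂ 4∣τ₁+τ₂+2
    ... | no q₁≰p₂ | no q₂≰q₁ | inj₁ p₁<p₂ =
      crossing⇒C4 T₁ T₂ 2∣l₁ 2∣l₂ P∥Q p₁<p₂ (≰⇒> q₁≰p₂) (≰⇒> q₂≰q₁) (<-≤-trans q₂<L (m≤n+m L p₁))
    ... | no _ | no q₂≰q₁ | inj₂ refl =
      nested⇒C4 T₂ T₁ 2∣l₂ (IntDisjoint-sym P Q P∥Q) ≤-refl p₁<q₁ (<⇒≤ (≰⇒> q₂≰q₁)) (<-≤-trans q₂<L (m≤n+m L p₂))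
        ¬2∣d₁ (∣x+y+c⇒∣y+x+c (Path.len P + (q₁ ∸ p₁)) (Path.len Q + (q₂ ∸ p₂)) 4∣τ₁+τ₂+2)

    odd-pair⇒C4 : ∀ {P Q} (X : Placed P) (Y : Placed Q) → 2 ∣ Path.len P → 2 ∣ Path.len Q
      → IntDisjoint G P Q → ¬ 2 ∣ span X → ¬ 2 ∣ span Y
      → 4 ∣ (Path.len P + span X) + (Path.len Q + span Y) + 2 → HasC4In G H
    odd-pair⇒C4 {P} {Q} X Y 2∣l₁ 2∣l₂ P∥Q ¬2∣d₁ ¬2∣d₂ 4∣τ₁+τ₂+2 =
      [ (λ p₁≤p₂ → ordered-odd-pair⇒C4 X.traversal Y.traversal 2∣l₁ 2∣l₂ P∥Q p₁≤p₂ X.p<q Y.p<q X.q<L Y.q<L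
                     ¬2∣d₁ ¬2∣d₂ 4∣τ₁+τ₂+2)
      , (λ p₂≤p₁ → ordered-odd-pair⇒C4 Y.traversal X.traversal 2∣l₂ 2∣l₁ (IntDisjoint-sym P Q P∥Q) p₂≤p₁
                     Y.p<q X.p<q Y.q<L X.q<L ¬2∣d₂ ¬2∣d₁
                     (∣x+y+c⇒∣y+x+c (Path.len P + span X) (Path.len Q + span Y) 4∣τ₁+τ₂+2))
      ]′ (≤-total X.p Y.p)
      where
      module X = Placed X
      module Y = Placed Y

    three-placed⇒C4 : ∀ {P₁ P₂ P₃} (X₁ : Placed P₁) (X₂ : Placed P₂) (X₃ : Placed P₃)
      → 2 ∣ Path.len P₁ → 2 ∣ Path.len P₂ → 2 ∣ Path.len P₃
      → IntDisjoint G P₁ P₂ → IntDisjoint G P₁ P₃ → IntDisjoint G P₂ P₃ → HasC4In G H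
    three-placed⇒C4 X₁ X₂ X₃ 2∣l₁ 2∣l₂ 2∣l₃ P₁∥P₂ P₁∥P₃ P₂∥P₃ with 2 ∣? span X₁ | 2 ∣? span X₂ | 2 ∣? span X₃
    ... | yes 2∣d₁ | _ | _ = placed-even-span⇒C4 X₁ 2∣l₁ 2∣d₁
    ... | _ | yes 2∣d₂ | _ = placed-even-span⇒C4 X₂ 2∣l₂ 2∣d₂
    ... | _ | _ | yes 2∣d₃ = placed-even-span⇒C4 X₃ 2∣l₃ 2∣d₃
    ... | no ¬2∣d₁ | no ¬2∣d₂ | no ¬2∣d₃
      with odd-pigeonhole (2∣m⇒¬2∣n⇒¬2∣m+n 2∣l₁ ¬2∣d₁) (2∣m⇒¬2∣n⇒¬2∣m+n 2∣l₂ ¬2∣d₂) (2∣m⇒¬2∣n⇒¬2∣m+n 2∣l₃ ¬2∣d₃)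
    ...   | inj₁ 4∣τ₁+τ₂+2        = odd-pair⇒C4 X₁ X₂ 2∣l₁ 2∣l₂ P₁∥P₂ ¬2∣d₁ ¬2∣d₂ 4∣τ₁+τ₂+2
    ...   | inj₂ (inj₁ 4∣τ₁+τ₃+2) = odd-pair⇒C4 X₁ X₃ 2∣l₁ 2∣l₃ P₁∥P₃ ¬2∣d₁ ¬2∣d₃ 4∣τ₁+τ₃+2
    ...   | inj₂ (inj₂ 4∣τ₂+τ₃+2) = odd-pair⇒C4 X₂ X₃ 2∣l₂ 2∣l₃ P₂∥P₃ ¬2∣d₂ ¬2∣d₃ 4∣τ₂+τ₃+2

    three-bridges⇒C4 : ∀ P₁ P₂ P₃ → Bridge G C P₁ → Bridge G C P₂ → Bridge G C P₃
      → (∀ {u v} → EdgeP G P₁ u v → H u v) → (∀ {u v} → EdgeP G P₂ u v → H u v)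
      → (∀ {u v} → EdgeP G P₃ u v → H u v)
      → 2 ∣ Path.len P₁ → 2 ∣ Path.len P₂ → 2 ∣ Path.len P₃
      → IntDisjoint G P₁ P₂ → IntDisjoint G P₁ P₃ → IntDisjoint G P₂ P₃ → HasC4In G H
    three-bridges⇒C4 P₁ P₂ P₃ B₁ B₂ B₃ P₁⊆H P₂⊆H P₃⊆H =
      three-placed⇒C4 (placed P₁ B₁ P₁⊆H) (placed P₂ B₂ P₂⊆H) (placed P₃ B₃ P₃⊆H)

reduce-to-L≡2[mod4] : ∀ G C {H} → 2 ∣ Cycle.len C → (∀ {u v} → EdgeC G C u v → H u v)
  → (4 ∣ Cycle.len C + 2 → HasC4In G H) → HasC4In G H
reduce-to-L≡2[mod4] G C 2∣L C⊆H L≡2⇒C4 with 2∣n⇒4∣n⊎4∣n+2 2∣L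
... | inj₁ 4∣L   = C , 4∣L , λ _ _ → C⊆H
... | inj₂ 4∣L+2 = L≡2⇒C4 4∣L+2

lemma3 : (G : Graph) (C : Cycle G) (P₁ P₂ P₃ : Path G)
    → 2 ∣ Cycle.len C
    → Bridge G C P₁ → Bridge G C P₂ → Bridge G C P₃
    → 2 ∣ Path.len P₁ → 2 ∣ Path.len P₂ → 2 ∣ Path.len P₃
    → ((∃[ s ] (SpanIs G C P₁ s × 2 ∣ s)) → HasC4In G (E∪₁ G C P₁))
    × (Crossed G C P₁ P₂ → HasC4In G (E∪₂ G C P₁ P₂))
    × (IntDisjoint G P₁ P₂ → IntDisjoint G P₁ P₃ → IntDisjoint G P₂ P₃
       → HasC4In G (E∪₃ G C P₁ P₂ P₃))
lemma3 G C P₁ P₂ P₃ 2∣L B₁ B₂ B₃ 2∣l₁ 2∣l₂ 2∣l₃ =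
    (λ span → reduce-to-L≡2[mod4] G C 2∣L inj₁ (λ 4∣L+2 →
      OnCycle.span-even⇒C4 G C ∪₁-sym ∪₁⊆Adj inj₁ 4∣L+2 P₁ B₁ inj₂ 2∣l₁ span))
  , (λ crossed → reduce-to-L≡2[mod4] G C 2∣L inj₁ (λ 4∣L+2 →
      OnCycle.crossed⇒C4 G C ∪₂-sym ∪₂⊆Adj inj₁ 4∣L+2 P₁ P₂ B₁ B₂ (inj₂ ∘ inj₁) (inj₂ ∘ inj₂)
        2∣l₁ 2∣l₂ crossed))
  , (λ P₁∥P₂ P₁∥P₃ P₂∥P₃ → reduce-to-L≡2[mod4] G C 2∣L inj₁ (λ 4∣L+2 →
      OnCycle.three-bridges⇒C4 G C ∪₃-sym ∪₃⊆Adj inj₁ 4∣L+2 P₁ P₂ P₃ B₁ B₂ B₃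
        (inj₂ ∘ inj₁) (inj₂ ∘ inj₂ ∘ inj₁) (inj₂ ∘ inj₂ ∘ inj₂) 2∣l₁ 2∣l₂ 2∣l₃ P₁∥P₂ P₁∥P₃ P₂∥P₃))
  where
  ∪₁-sym : ∀ {u v} → E∪₁ G C P₁ u v → E∪₁ G C P₁ v u
  ∪₁-sym = map⊎ (EdgeC-sym C) (EdgeP-sym P₁)
  ∪₁⊆Adj : ∀ {u v} → E∪₁ G C P₁ u v → Adj G u v
  ∪₁⊆Adj = [ EdgeC⇒Adj C , EdgeP⇒Adj P₁ ]′
  ∪₂-sym : ∀ {u v} → E∪₂ G C P₁ P₂ u v → E∪₂ G C P₁ P₂ v u
  ∪₂-sym = map⊎ (EdgeC-sym C) (map⊎ (EdgeP-sym P₁) (EdgeP-sym P₂))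
  ∪₂⊆Adj : ∀ {u v} → E∪₂ G C P₁ P₂ u v → Adj G u v
  ∪₂⊆Adj = [ EdgeC⇒Adj C , [ EdgeP⇒Adj P₁ , EdgeP⇒Adj P₂ ]′ ]′
  ∪₃-sym : ∀ {u v} → E∪₃ G C P₁ P₂ P₃ u v → E∪₃ G C P₁ P₂ P₃ v u
  ∪₃-sym = map⊎ (EdgeC-sym C) (map⊎ (EdgeP-sym P₁) (map⊎ (EdgeP-sym P₂) (EdgeP-sym P₃)))
  ∪₃⊆Adj : ∀ {u v} → E∪₃ G C P₁ P₂ P₃ u v → Adj G u v
  ∪₃⊆Adj = [ EdgeC⇒Adj C , [ EdgeP⇒Adj P₁ , [ EdgeP⇒Adj P₂ , EdgeP⇒Adj P₃ ]′ ]′ ]′
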